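{- $\sigma^{ - }(P(12,5)) \geq 8$.
   Context: The generalized Petersen graph $P(12,5)$ (the Nauru graph) has vertex set $\{u_i, v_i : i=0,1,\dots,11\}$ and edge set $\{u_iu_{i+1},\ u_iv_i,\ v_iv_{i+5} : i=0,\dots,11\}$, subscripts read modulo $12$. For a simple connected graph $G$ of order $N$, the \textbf{rna} number $\sigma^{ - }(G)$ is the minimum, over all bijections $f: V(G)\to\{1,2,\dots,N\}$, of the number of edges $uv$ of $G$ such that $f(u)$ and $f(v)$ have different parity. -}

module Defs where

open import Data.Nat using (ℕ; suc; _+_; _%_)
open import Data.Fin using (Fin; toℕ)
open import Data.Bool using (Bool; true; false; if_then_else_)
open import Data.List using (List; []; _∷_; map; concatMap; length; filter; allFin)
open import Data.Product using (_×_; _,_)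
open import Relation.Binary.PropositionalEquality using (_≡_)
open import Relation.Nullary using (¬_)
open import Relation.Nullary.Decidable using (does; ¬?)
import Data.Nat as N
import Data.Nat.Properties as NP
import Data.Nat.DivMod as DM

data V : Set where
  u : Fin 12 → V
  v : Fin 12 → V

_⊕_ : Fin 12 → ℕ → Fin 12
i ⊕ k = Data.Fin.fromℕ< (DM.m%n<n (toℕ i N.+ k) 12)

edgesOfI : Fin 12 → List (V × V)
edgesOfI i = (u i , u (i ⊕ 1)) ∷ (u i , v i) ∷ (v i , v (i ⊕ 5)) ∷ []

edges : List (V × V)
edges = concatMap edgesOfI (allFin 12)

label : (V → Fin 24) → V → ℕ
label f x = suc (toℕ (f x))

parity : ℕ → ℕ
parity n = n % 2

oddEdges : (V → Fin 24) → ℕ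
oddEdges f = length (filter (λ e → ¬? (parity (label f (Data.Product.proj₁ e)) NP.≟ parity (label f (Data.Product.proj₂ e)))) edges)

-- Number the vertices u_i ↦ 2i and v_i ↦ 2i+1 and colour each vertex by the parity of its
-- label.  A bijective labelling by 1,…,24 gives exactly 12 vertices of each colour, and the
-- edges with labels of different parity are the bichromatic edges, so it suffices to show that
-- every balanced 2-colouring of the Nauru graph has at least 8 bichromatic edges.  This is
-- checked by a branch-and-bound search over partial colourings of the vertices 0,…,k−1,
-- pruned as soon as 8 edges among the coloured vertices are bichromatic or a colour is used
-- more than 12 times; the search is evaluated by the type checker.
module Submission where

open import Defs
open import Data.Nat using (_≤_)
open import Data.Fin using (Fin)
open import Function.Definitions using (Bijective)
open import Relation.Binary.PropositionalEquality using (_≡_)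

open import Data.Bool using (Bool; true; false; T; _∧_; _∨_; _xor_; if_then_else_)
import Data.Bool.Properties as BoolP
open import Data.Empty using (⊥-elim)
open import Data.Fin using (toℕ; inject₁; fromℕ)
import Data.Fin.Properties as FinP
open import Data.Fin.Permutation using (Permutation′)
open import Data.List using (List; []; _∷_; _++_; map; filter; length; concatMap; upTo)
open import Data.Nat using (ℕ; zero; suc; _+_; _*_; _<_; _%_; _/_; _≡ᵇ_; _<ᵇ_; _≤ᵇ_; z≤n; s≤s)
open import Data.Nat.DivMod using (_mod_; m%n<n)
open import Data.Nat.Properties
open import Data.Product using (_×_; _,_; proj₁; proj₂)
open import Data.Sum using (inj₁; inj₂)
open import Data.Unit using (tt)
open import Function using (_∘_; Equivalence)
open import Function.Bundles using (_↔_; mk⤖; mk↔ₛ′)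
open import Function.Construct.Composition using (_↔-∘_)
open import Function.Properties.Bijection using (⤖⇒↔)
open import Relation.Binary.PropositionalEquality using (refl; sym; trans; cong; cong₂; subst; module ≡-Reasoning)
open import Relation.Nullary using (¬_; Dec; no; does)
open import Relation.Nullary.Decidable using (¬?; toWitness; map′)
open import Relation.Binary.Definitions using (DecidableEquality)
open import Algebra.Properties.CommutativeSemigroup +-commutativeSemigroup
  using () renaming (interchange to +-interchange)
open import Algebra.Properties.CommutativeMonoid.Sum +-0-commutativeMonoid
  using (sum; sum-permute; sum-init-last; sum-cong-≗)

Edge : Set
Edge = ℕ × ℕ

Colouring : Set
Colouring = ℕ → Bool

count : {A : Set} → (A → Bool) → List A → ℕ
count P []       = 0
count P (x ∷ xs) = if P x then suc (count P xs) else count P xs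

count-cong : {A : Set} {P R : A → Bool} (xs : List A) → (∀ x → P x ≡ R x) → count P xs ≡ count R xs
count-cong []       P≗R = refl
count-cong {R = R} (x ∷ xs) P≗R rewrite P≗R x with R x
... | true  = cong suc (count-cong xs P≗R)
... | false = count-cong xs P≗R

count-mono : {A : Set} {P R : A → Bool} (xs : List A) → (∀ x → T (P x) → T (R x)) → count P xs ≤ count R xs
count-mono []       P⇒R = z≤n
count-mono {P = P} {R} (x ∷ xs) P⇒R with P x | R x | P⇒R x
... | true  | true  | _   = s≤s (count-mono xs P⇒R)
... | true  | false | p⇒r = ⊥-elim (p⇒r tt)
... | false | true  | _   = m≤n⇒m≤1+n (count-mono xs P⇒R)
... | false | false | _   = count-mono xs P⇒R

count-++ : {A : Set} (P : A → Bool) (xs ys : List A) → count P (xs ++ ys) ≡ count P xs + count P ys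
count-++ P []       ys = refl
count-++ P (x ∷ xs) ys with P x
... | true  = cong suc (count-++ P xs ys)
... | false = count-++ P xs ys

count-concatMap : {A B : Set} {P R : A → Bool} {Q : B → Bool} (f : A → List B) →
                  (∀ x → count P (x ∷ []) ≡ count Q (f x) + count R (x ∷ [])) →
                  ∀ xs → count P xs ≡ count Q (concatMap f xs) + count R xs
count-concatMap f split []       = refl
count-concatMap {P = P} {R} {Q} f split (x ∷ xs) = begin
  count P (x ∷ xs)
    ≡⟨ count-++ P (x ∷ []) xs ⟩
  count P (x ∷ []) + count P xs
    ≡⟨ cong₂ _+_ (split x) (count-concatMap f split xs) ⟩
  (count Q (f x) + count R (x ∷ [])) + (count Q (concatMap f xs) + count R xs)
    ≡⟨ +-interchange (count Q (f x)) _ _ _ ⟩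
  (count Q (f x) + count Q (concatMap f xs)) + (count R (x ∷ []) + count R xs)
    ≡⟨ cong₂ _+_ (count-++ Q (f x) (concatMap f xs)) (count-++ R (x ∷ []) xs) ⟨
  count Q (concatMap f (x ∷ xs)) + count R (x ∷ xs) ∎
  where open ≡-Reasoning

bichromatic : Colouring → Edge → Bool
bichromatic a (i , j) = a i xor a j

cutSize : Colouring → List Edge → ℕ
cutSize a = count (bichromatic a)

spannedBichromatic : ℕ → Colouring → Edge → Bool
spannedBichromatic k a (i , j) = (i <ᵇ k) ∧ (j <ᵇ k) ∧ (a i xor a j)

spannedCutSize : ℕ → Colouring → List Edge → ℕ
spannedCutSize k a = count (spannedBichromatic k a)

spannedCutSize≤cutSize : ∀ k a E → spannedCutSize k a E ≤ cutSize a E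
spannedCutSize≤cutSize k a E = count-mono E spanned⇒bichromatic
  where
  spanned⇒bichromatic : ∀ e → T (spannedBichromatic k a e) → T (bichromatic a e)
  spanned⇒bichromatic (i , j) t with i <ᵇ k | j <ᵇ k
  ... | true | true = t

δ : Bool → Bool → ℕ
δ b c = if does (b BoolP.≟ c) then 1 else 0

colourCount : Bool → ℕ → Colouring → ℕ
colourCount b zero    a = 0
colourCount b (suc k) a = δ (a k) b + colourCount b k a

colourCount-mono : ∀ b a {k n} → k ≤ n → colourCount b k a ≤ colourCount b n a
colourCount-mono b a {n = zero}  z≤n = ≤-refl
colourCount-mono b a {k} {suc n} k≤1+n with m≤n⇒m<n∨m≡n k≤1+n
... | inj₁ k<1+n = ≤-trans (colourCount-mono b a (≤-pred k<1+n)) (m≤n+m _ _)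
... | inj₂ refl  = ≤-refl

colourCount≡sum : ∀ b n a → colourCount b n a ≡ sum {n} (λ i → δ (a (toℕ i)) b)
colourCount≡sum b zero    a = refl
colourCount≡sum b (suc n) a = begin
  δ (a n) b + colourCount b n a
    ≡⟨ +-comm (δ (a n) b) _ ⟩
  colourCount b n a + δ (a n) b
    ≡⟨ cong₂ _+_ (colourCount≡sum b n a) (cong (λ i → δ (a i) b) (sym (FinP.toℕ-fromℕ n))) ⟩
  sum {n} (λ i → δ (a (toℕ i)) b) + δ (a (toℕ (fromℕ n))) b
    ≡⟨ cong (_+ δ (a (toℕ (fromℕ n))) b) (sum-cong-≗ {n} (λ i → cong (λ j → δ (a j) b) (sym (FinP.toℕ-inject₁ i)))) ⟩
  sum {n} (λ i → δ (a (toℕ (inject₁ i))) b) + δ (a (toℕ (fromℕ n))) b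
    ≡⟨ sum-init-last {n} (λ i → δ (a (toℕ i)) b) ⟨
  sum {suc n} (λ i → δ (a (toℕ i)) b) ∎
  where open ≡-Reasoning

AgreeBelow : ℕ → Colouring → Colouring → Set
AgreeBelow k p a = ∀ {i} → i < k → p i ≡ a i

extend : Colouring → ℕ → Bool → Colouring
extend p k b i = if i ≡ᵇ k then b else p i

extend-at : ∀ p k b → extend p k b k ≡ b
extend-at p k b with k ≡ᵇ k | ≡⇒≡ᵇ k k refl
... | true | _ = refl

extend-agreeBelow-self : ∀ {k} p b → AgreeBelow k (extend p k b) p
extend-agreeBelow-self {k} p b {i} i<k with i ≡ᵇ k | ≡ᵇ⇒≡ i k
... | true  | i≡k = ⊥-elim (<-irrefl (i≡k tt) i<k)
... | false | _   = refl

extend-agreeBelow : ∀ {k p a} → AgreeBelow k p a → AgreeBelow (suc k) (extend p k (a k)) a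
extend-agreeBelow {k} {a = a} p≈a {i} i<1+k with i ≡ᵇ k | ≡ᵇ⇒≡ i k | ≡⇒≡ᵇ i k
... | true  | i≡k | _   = cong a (sym (i≡k tt))
... | false | _   | i≢k = p≈a (≤∧≢⇒< (≤-pred i<1+k) i≢k)

spannedCutSize-agreeBelow : ∀ {k p a} E → AgreeBelow k p a → spannedCutSize k p E ≡ spannedCutSize k a E
spannedCutSize-agreeBelow {k} {p} {a} E p≈a = count-cong E agree
  where
  agree : ∀ e → spannedBichromatic k p e ≡ spannedBichromatic k a e
  agree (i , j) with i <ᵇ k | <ᵇ⇒< i k | j <ᵇ k | <ᵇ⇒< j k
  ... | false | _   | _     | _   = refl
  ... | true  | i<k | false | _   = refl
  ... | true  | i<k | true  | j<k = cong₂ _xor_ (p≈a (i<k tt)) (p≈a (j<k tt))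

colourCount-agreeBelow : ∀ b {k p a} → AgreeBelow k p a → colourCount b k p ≡ colourCount b k a
colourCount-agreeBelow b {zero}  p≈a = refl
colourCount-agreeBelow b {suc k} p≈a =
  cong₂ _+_ (cong (λ c → δ c b) (p≈a (n<1+n k))) (colourCount-agreeBelow b (p≈a ∘ m<n⇒m<1+n))

colourCount-extend : ∀ b c k p → colourCount b (suc k) (extend p k c) ≡ δ c b + colourCount b k p
colourCount-extend b c k p =
  cong₂ _+_ (cong (λ x → δ x b) (extend-at p k c)) (colourCount-agreeBelow b (extend-agreeBelow-self {k} p c))

backNeighbour : ℕ → Edge → List ℕ
backNeighbour k (i , j) =
  if (i ≡ᵇ k) ∧ (j <ᵇ k) then j ∷ [] else if (j ≡ᵇ k) ∧ (i <ᵇ k) then i ∷ [] else []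

backNeighbours : List Edge → ℕ → List ℕ
backNeighbours E k = concatMap (backNeighbour k) E

data Position : Bool → Bool → Bool → Set where
  below : Position true  false true
  at    : Position false true  true
  above : Position false false false

position : ∀ i k → Position (i <ᵇ k) (i ≡ᵇ k) (i <ᵇ suc k)
position zero    zero    = at
position zero    (suc k) = below
position (suc i) zero    = above
position (suc i) (suc k) = position i k

spannedBichromatic-extend : ∀ k p b e →
  count (spannedBichromatic (suc k) (extend p k b)) (e ∷ [])
    ≡ count (λ i → p i xor b) (backNeighbour k e) + count (spannedBichromatic k p) (e ∷ [])
spannedBichromatic-extend k p b (i , j)
  with i <ᵇ k | i ≡ᵇ k | i <ᵇ suc k | position i k | j <ᵇ k | j ≡ᵇ k | j <ᵇ suc k | position j k
... | _ | _ | _ | below | _ | _ | _ | below = refl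
... | _ | _ | _ | below | _ | _ | _ | at    = sym (+-identityʳ _)
... | _ | _ | _ | below | _ | _ | _ | above = refl
... | _ | _ | _ | at    | _ | _ | _ | below =
  trans (cong (λ c → if c then 1 else 0) (BoolP.xor-comm b (p j))) (sym (+-identityʳ _))
... | _ | _ | _ | at    | _ | _ | _ | at    = cong (λ c → if c then 1 else 0) (BoolP.xor-same b)
... | _ | _ | _ | at    | _ | _ | _ | above = refl
... | _ | _ | _ | above | _ | _ | _ | below = refl
... | _ | _ | _ | above | _ | _ | _ | at    = refl
... | _ | _ | _ | above | _ | _ | _ | above = refl

spannedCutSize-extend : ∀ E k p b → spannedCutSize (suc k) (extend p k b) E
                                    ≡ count (λ i → p i xor b) (backNeighbours E k) + spannedCutSize k p E
spannedCutSize-extend E k p b = count-concatMap (backNeighbour k) (spannedBichromatic-extend k p b) E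

record Tally : Set where
  constructor ⟨_,_,_⟩
  field
    cut trues falses : ℕ

⟨,,⟩-cong : ∀ {c c′ t t′ f f′} → c ≡ c′ → t ≡ t′ → f ≡ f′ → ⟨ c , t , f ⟩ ≡ ⟨ c′ , t′ , f′ ⟩
⟨,,⟩-cong refl refl refl = refl

module BranchAndBound (E : List Edge) (n h m : ℕ) where

  Balanced : Colouring → Set
  Balanced a = ∀ b → colourCount b n a ≡ h

  tally : ℕ → Colouring → Tally
  tally k p = ⟨ spannedCutSize k p E , colourCount true k p , colourCount false k p ⟩

  addVertex : List ℕ → Colouring → Bool → Tally → Tally
  addVertex ns p b ⟨ cut , trues , falses ⟩ =
    ⟨ count (λ i → p i xor b) ns + cut , δ b true + trues , δ b false + falses ⟩

  tally-extend : ∀ k p b → tally (suc k) (extend p k b) ≡ addVertex (backNeighbours E k) p b (tally k p)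
  tally-extend k p b =
    ⟨,,⟩-cong (spannedCutSize-extend E k p b) (colourCount-extend true b k p) (colourCount-extend false b k p)

  backNeighbourTable : ℕ → ℕ → List (List ℕ)
  backNeighbourTable k zero    = []
  backNeighbourTable k (suc r) = backNeighbours E k ∷ backNeighbourTable (suc k) r

  prunable : Tally → Bool
  prunable ⟨ cut , trues , falses ⟩ = (m ≤ᵇ cut) ∨ (h <ᵇ trues) ∨ (h <ᵇ falses)

  -- The table of back-neighbours of the uncoloured vertices is passed down the search tree so that
  -- each entry is computed only once.
  refuted : List (List ℕ) → ℕ → Colouring → Tally → Bool
  refuted []           k p s = prunable s
  refuted (ns ∷ table) k p s = prunable s ∨ (child true ∧ child false)
    where
    child : Bool → Bool
    child b = refuted table (suc k) (extend p k b) (addVertex ns p b s)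

  module _ {a : Colouring} (balanced : Balanced a) where

    overused-colour-impossible : ∀ b {k p} → k ≤ n → AgreeBelow k p a → ¬ T (h <ᵇ colourCount b k p)
    overused-colour-impossible b {k} {p} k≤n p≈a overused = <⇒≱ (<ᵇ⇒< h (colourCount b k p) overused) (begin
      colourCount b k p ≡⟨ colourCount-agreeBelow b p≈a ⟩
      colourCount b k a ≤⟨ colourCount-mono b a k≤n ⟩
      colourCount b n a ≡⟨ balanced b ⟩
      h                 ∎)
      where open ≤-Reasoning

    prunable-sound : ∀ {k p} → k ≤ n → AgreeBelow k p a → T (prunable (tally k p)) → m ≤ cutSize a E
    prunable-sound {k} {p} k≤n p≈a pruned with Equivalence.to BoolP.T-∨ pruned
    ... | inj₁ cutFound = begin
      m                    ≤⟨ ≤ᵇ⇒≤ m _ cutFound ⟩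
      spannedCutSize k p E ≡⟨ spannedCutSize-agreeBelow E p≈a ⟩
      spannedCutSize k a E ≤⟨ spannedCutSize≤cutSize k a E ⟩
      cutSize a E          ∎
      where open ≤-Reasoning
    ... | inj₂ overused with Equivalence.to BoolP.T-∨ overused
    ...   | inj₁ trues  = ⊥-elim (overused-colour-impossible true  k≤n p≈a trues)
    ...   | inj₂ falses = ⊥-elim (overused-colour-impossible false k≤n p≈a falses)

    refuted-sound : ∀ r {k p} → r + k ≡ n → AgreeBelow k p a →
                    T (refuted (backNeighbourTable k r) k p (tally k p)) → m ≤ cutSize a E
    refuted-sound zero    refl p≈a pruned = prunable-sound ≤-refl p≈a pruned
    refuted-sound (suc r) {k} {p} r+k≡n p≈a t with Equivalence.to BoolP.T-∨ t
    ... | inj₁ pruned   = prunable-sound (subst (k ≤_) r+k≡n (m≤n+m k (suc r))) p≈a pruned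
    ... | inj₂ children = refuted-sound r (trans (+-suc r k) r+k≡n) (extend-agreeBelow p≈a) (child (a k))
      where
      child : ∀ b → T (refuted (backNeighbourTable (suc k) r) (suc k) (extend p k b) (tally (suc k) (extend p k b)))
      child true  rewrite tally-extend k p true  = proj₁ (Equivalence.to BoolP.T-∧ children)
      child false rewrite tally-extend k p false = proj₂ (Equivalence.to BoolP.T-∧ children)

  balanced-cut-bound : refuted (backNeighbourTable 0 n) 0 (λ _ → false) (tally 0 (λ _ → false)) ≡ true →
                       ∀ a → Balanced a → m ≤ cutSize a E
  balanced-cut-bound t a balanced =
    refuted-sound balanced n (+-identityʳ n) (λ ()) (Equivalence.from BoolP.T-≡ t)

nauruEdges : List Edge
nauruEdges = concatMap spokes (upTo 12)
  where
  spokes : ℕ → List Edge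
  spokes i = (2 * i , 2 * ((i + 1) % 12)) ∷ (2 * i , 2 * i + 1) ∷ (2 * i + 1 , 2 * ((i + 5) % 12) + 1) ∷ []

open BranchAndBound nauruEdges 24 12 8

-- Stated with ≡ true rather than T: the type checker evaluates it much faster in this form.
nauru-refuted : refuted (backNeighbourTable 0 24) 0 (λ _ → false) (tally 0 (λ _ → false)) ≡ true
nauru-refuted = refl

vertex : ℕ → V
vertex i = if i % 2 ≡ᵇ 0 then u ((i / 2) mod 12) else v ((i / 2) mod 12)

vertexIndex : V → Fin 24
vertexIndex (u i) = (2 * toℕ i) mod 24
vertexIndex (v i) = (1 + 2 * toℕ i) mod 24

vertexPair : Edge → V × V
vertexPair (i , j) = vertex i , vertex j

edges≡nauruEdges : edges ≡ map vertexPair nauruEdges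
edges≡nauruEdges = refl

isOdd : ℕ → Bool
isOdd x = x % 2 ≡ᵇ 1

oddLabelled : (V → Fin 24) → Colouring
oddLabelled f i = isOdd (label f (vertex i))

length-filter-map : {A B : Set} {P : B → Set} (P? : ∀ x → Dec (P x)) (g : A → B) (xs : List A) →
                    length (filter P? (map g xs)) ≡ count (λ x → does (P? (g x))) xs
length-filter-map P? g []       = refl
length-filter-map P? g (x ∷ xs) with does (P? (g x))
... | true  = cong suc (length-filter-map P? g xs)
... | false = length-filter-map P? g xs

parity-differs : ∀ x y → does (¬? (parity x ≟ parity y)) ≡ isOdd x xor isOdd y
parity-differs x y = residues (x % 2) (y % 2) (m%n<n x 2) (m%n<n y 2)
  where
  residues : ∀ r s → r < 2 → s < 2 → does (¬? (r ≟ s)) ≡ (r ≡ᵇ 1) xor (s ≡ᵇ 1)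
  residues 0 0 _ _ = refl
  residues 0 1 _ _ = refl
  residues 1 0 _ _ = refl
  residues 1 1 _ _ = refl
  residues (suc (suc _)) _             (s≤s (s≤s ())) _
  residues 0             (suc (suc _)) _ (s≤s (s≤s ()))
  residues 1             (suc (suc _)) _ (s≤s (s≤s ()))

oddEdges≡cutSize : ∀ f → oddEdges f ≡ cutSize (oddLabelled f) nauruEdges
oddEdges≡cutSize f = begin
  length (filter differentParity edges)
    ≡⟨ cong (length ∘ filter differentParity) edges≡nauruEdges ⟩
  length (filter differentParity (map vertexPair nauruEdges))
    ≡⟨ length-filter-map differentParity vertexPair nauruEdges ⟩
  count (λ e → does (differentParity (vertexPair e))) nauruEdges
    -- explicit predicates: inferring them would make Agda unfold count over the concrete edge list
    ≡⟨ count-cong {P = λ e → does (differentParity (vertexPair e))} {R = bichromatic (oddLabelled f)}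
                  nauruEdges (λ (i , j) → parity-differs (label f (vertex i)) (label f (vertex j))) ⟩
  cutSize (oddLabelled f) nauruEdges ∎
  where
  open ≡-Reasoning
  differentParity : (e : V × V) → Dec (¬ parity (label f (proj₁ e)) ≡ parity (label f (proj₂ e)))
  differentParity e = ¬? (parity (label f (proj₁ e)) ≟ parity (label f (proj₂ e)))

_≟V_ : DecidableEquality V
u i ≟V u j = map′ (cong u) (λ { refl → refl }) (i FinP.≟ j)
u _ ≟V v _ = no (λ ())
v _ ≟V u _ = no (λ ())
v i ≟V v j = map′ (cong v) (λ { refl → refl }) (i FinP.≟ j)

vertex-vertexIndex : ∀ x → vertex (toℕ (vertexIndex x)) ≡ x
vertex-vertexIndex (u i) = toWitness {a? = FinP.all? (λ i → vertex (toℕ (vertexIndex (u i))) ≟V u i)} tt i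
vertex-vertexIndex (v i) = toWitness {a? = FinP.all? (λ i → vertex (toℕ (vertexIndex (v i))) ≟V v i)} tt i

vertexIndex-vertex : ∀ i → vertexIndex (vertex (toℕ i)) ≡ i
vertexIndex-vertex = toWitness {a? = FinP.all? (λ i → vertexIndex (vertex (toℕ i)) FinP.≟ i)} tt

Fin24↔V : Fin 24 ↔ V
Fin24↔V = mk↔ₛ′ (vertex ∘ toℕ) vertexIndex vertex-vertexIndex vertexIndex-vertex

labels-balanced : ∀ b → sum {24} (λ j → δ (isOdd (suc (toℕ j))) b) ≡ 12
labels-balanced true  = refl
labels-balanced false = refl

oddLabelled-balanced : ∀ f → Bijective _≡_ _≡_ f → Balanced (oddLabelled f)
oddLabelled-balanced f bijective b = begin
  colourCount b 24 (oddLabelled f)                ≡⟨ colourCount≡sum b 24 (oddLabelled f) ⟩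
  sum {24} (λ i → δ (oddLabelled f (toℕ i)) b)   ≡⟨ sum-permute labelIsOdd π ⟨
  sum {24} labelIsOdd                             ≡⟨ labels-balanced b ⟩
  12                                              ∎
  where
  open ≡-Reasoning
  labelIsOdd : Fin 24 → ℕ
  labelIsOdd j = δ (isOdd (suc (toℕ j))) b
  π : Permutation′ 24
  π = ⤖⇒↔ (mk⤖ bijective) ↔-∘ Fin24↔V

lemma5p6 : (f : V → Fin 24) → Bijective _≡_ _≡_ f → 8 ≤ oddEdges f
lemma5p6 f bijective = subst (8 ≤_) (sym (oddEdges≡cutSize f))
  (balanced-cut-bound nauru-refuted (oddLabelled f) (oddLabelled-balanced f bijective))
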